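{- Let $n\ge 1$ and $0\le k\le n$ be integers with $n\neq 2k$. Then the Johnson graph $J(n,k)$ is not a square.
   Context: The Johnson graph $J(n,k)$ has as vertices the $k$-element subsets of $\{1,\dots,n\}$, two being adjacent iff their intersection has exactly $k-1$ elements. All graphs are finite and simple. A partially labeled graph is a graph $H$ together with an injective map $\theta: L\to V(H)$, $L\subseteq\mathbb{N}$, whose image $\theta(L)$ is nonempty and a proper subset of $V(H)$; vertices in $\theta(L)$ are labeled. The square $HH$ is obtained from two disjoint copies of $H$ by identifying each labeled vertex $\theta(\ell)$ of the first copy with $\theta(\ell)$ of the second copy (keeping all edges, merging double edges). A graph $G$ is a square if $G\cong HH$ for some partially labeled graph $H$. -}

module Defs where

open import Data.Nat using (ℕ; suc; _+_; _≤_)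
open import Data.Fin using (Fin; _≟_)
open import Data.Fin.Properties using (any?)
open import Data.Fin.Subset using (Subset; _∩_; ∣_∣)
open import Data.Bool using (Bool; true; false; T)
open import Data.Product using (Σ; ∃; _×_; _,_; proj₁)
open import Data.Sum using (_⊎_; inj₁; inj₂)
open import Relation.Binary.PropositionalEquality using (_≡_)
open import Relation.Nullary using (¬_)
open import Relation.Nullary.Decidable using (⌊_⌋)
open import Function.Bundles using (_⤖_; _⇔_; Bijection)
open import Function.Definitions using (Injective)

record SimpleGraph (m : ℕ) : Set where
  field
    adj        : Fin m → Fin m → Bool
    adj-sym    : ∀ u v → adj u v ≡ adj v u
    adj-irrefl : ∀ v → adj v v ≡ false

-- A graph given by an arbitrary vertex type and an adjacency relation
-- (used for J(n,k) and for squares HH, whose vertex sets are not literally Fin m).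
record GraphOn : Set₁ where
  field
    Vtx : Set
    Adj : Vtx → Vtx → Set

open GraphOn public

_≅_ : GraphOn → GraphOn → Set
G ≅ G' = Σ (Vtx G ⤖ Vtx G') λ f →
  ∀ x y → Adj G x y ⇔ Adj G' (Bijection.to f x) (Bijection.to f y)

record PartiallyLabeledGraph : Set where
  field
    h        : ℕ
    graph    : SimpleGraph h
    l        : ℕ
    θ        : Fin l → Fin h
    θ-inj    : Injective _≡_ _≡_ θ
    nonempty : 1 ≤ l
    proper   : ∃ λ (v : Fin h) → ∀ i → ¬ (θ i ≡ v)

  isLabeled : Fin h → Bool
  isLabeled v = ⌊ any? (λ i → θ i ≟ v) ⌋

open PartiallyLabeledGraph

-- The square HH: two disjoint copies of H with the labeled vertices identified.  Edges: those of either copy (double edges merged).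
SqVtx : PartiallyLabeledGraph → Set
SqVtx H = Fin (h H) ⊎ Σ (Fin (h H)) (λ v → isLabeled H v ≡ false)

SqAdj : (H : PartiallyLabeledGraph) → SqVtx H → SqVtx H → Set
SqAdj H (inj₁ u)       (inj₁ v)       = T (SimpleGraph.adj (graph H) u v)
SqAdj H (inj₁ u)       (inj₂ (v , _)) = T (isLabeled H u) × T (SimpleGraph.adj (graph H) u v)
SqAdj H (inj₂ (u , _)) (inj₁ v)       = T (isLabeled H v) × T (SimpleGraph.adj (graph H) u v)
SqAdj H (inj₂ (u , _)) (inj₂ (v , _)) = T (SimpleGraph.adj (graph H) u v)

square : PartiallyLabeledGraph → GraphOn
square H = record { Vtx = SqVtx H ; Adj = SqAdj H }

IsSquare : GraphOn → Set
IsSquare G = Σ PartiallyLabeledGraph λ H → G ≅ square H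

-- The Johnson graph J(n,k): k-subsets of {1..n} (as Subset n = Fin n-indexed Bool
-- vectors of cardinality k), adjacent iff their intersection has exactly k-1
-- elements (written |s ∩ t| + 1 = k to avoid truncated subtraction when k = 0).
Johnson : ℕ → ℕ → GraphOn
Johnson n k = record
  { Vtx = Σ (Subset n) (λ s → ∣ s ∣ ≡ k)
  ; Adj = λ s t → ∣ proj₁ s ∩ proj₁ t ∣ + 1 ≡ k
  }

-- The two copies of H in a square HH are swapped by an involutive automorphism fixing exactly
-- the labeled vertices; an unlabeled vertex is neither equal nor adjacent to its image, and all
-- their common neighbours are labeled. Transport this automorphism ψ to J(n,k). By connectedness
-- some fixed vertex s is adjacent to a vertex a that is not fixed; write a = s - a⁻ + a⁺ and
-- b = ψ a = s - b⁻ + b⁺, where a⁻ ≠ b⁻ and a⁺ ≠ b⁺ because a and b are at distance 2.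
-- Then s - a⁻ + b⁺ and s - b⁻ + a⁺ are common neighbours of a and b, hence fixed.
-- A k-set containing s - a⁻ is equal or adjacent to a, s and s - a⁻ + b⁺, so its image is equal
-- or adjacent to b, s and s - a⁻ + b⁺, which forces the image inside s ∪ {b⁺}. Thus ψ injects the
-- n - k + 1 k-sets containing s - a⁻ into the k + 1 k-subsets of s ∪ {b⁺}; symmetrically it
-- injects the k-subsets of s ∪ {a⁺} into the k-sets containing s - b⁻. Hence n - k + 1 = k + 1.

module Submission where

open import Defs

open import Axiom.UniquenessOfIdentityProofs using (module Decidable⇒UIP)
open import Data.Bool using (Bool; true; false; T)
import Data.Bool.Properties as 𝔹
open import Data.Fin using (Fin; zero; suc; _≟_; fromℕ<)
open import Data.Fin.Subset
open import Data.Fin.Subset.Properties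
open import Data.Nat using (ℕ; zero; suc; _+_; _*_; _∸_; _≤_; _<_; z≤n; s≤s)
open import Data.Nat.Induction using (<-wellFounded)
open import Data.Nat.Properties
  using (suc-injective; ≤-reflexive; ≤-<-trans; <⇒≱; ≤⇒≯; +-suc; +-comm; +-identityʳ;
         +-cancelˡ-≡; +-monoʳ-≤; n≤1⇒n≡0∨n≡1)
import Data.Nat.Properties as ℕ
open import Data.Product using (∃; ∃₂; _×_; _,_; proj₁; proj₂)
open import Data.Sum using (_⊎_; inj₁; inj₂)
open import Data.Unit using (tt)
open import Data.Vec using ([]; _∷_; here; there)
open import Function using (_∘_; case_of_)
open import Function.Bundles using (Bijection; Equivalence)
open import Induction.WellFounded using (Acc; acc)
open import Level using (0ℓ)
open import Relation.Binary.PropositionalEquality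
open import Relation.Nullary using (¬_; yes; no; contradiction)
open import Relation.Nullary.Decidable using (T?; fromWitness; toWitness)
open import Relation.Unary using (Pred; Decidable)

private variable
  n : ℕ
  p q r : Subset n
  x y : Fin n

x∈p─q⇒x∉q : ∀ (p q : Subset n) → x ∈ p ─ q → x ∉ q
x∈p─q⇒x∉q (_ ∷ p) (outside ∷ q) (there x∈p─q) (there x∈q) = x∈p─q⇒x∉q p q x∈p─q x∈q
x∈p─q⇒x∉q (_ ∷ p) (inside ∷ q)  (there x∈p─q) (there x∈q) = x∈p─q⇒x∉q p q x∈p─q x∈q

x∈p-y⇒x≢y : ∀ (p : Subset n) → x ∈ p - y → x ≢ y
x∈p-y⇒x≢y {y = y} p x∈p-y refl = x∈p─q⇒x∉q p ⁅ y ⁆ x∈p-y (x∈⁅x⁆ y)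

∣p∣≡∣p∩q∣+∣p─q∣ : ∀ (p q : Subset n) → ∣ p ∣ ≡ ∣ p ∩ q ∣ + ∣ p ─ q ∣
∣p∣≡∣p∩q∣+∣p─q∣ []            []            = refl
∣p∣≡∣p∩q∣+∣p─q∣ (inside ∷ p)  (inside ∷ q)  = cong suc (∣p∣≡∣p∩q∣+∣p─q∣ p q)
∣p∣≡∣p∩q∣+∣p─q∣ (inside ∷ p)  (outside ∷ q) =
  trans (cong suc (∣p∣≡∣p∩q∣+∣p─q∣ p q)) (sym (+-suc _ _))
∣p∣≡∣p∩q∣+∣p─q∣ (outside ∷ p) (inside ∷ q)  = ∣p∣≡∣p∩q∣+∣p─q∣ p q
∣p∣≡∣p∩q∣+∣p─q∣ (outside ∷ p) (outside ∷ q) = ∣p∣≡∣p∩q∣+∣p─q∣ p q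

x∈p⇒∣p∣≡1+∣p-x∣ : x ∈ p → ∣ p ∣ ≡ suc ∣ p - x ∣
x∈p⇒∣p∣≡1+∣p-x∣ {p = inside ∷ p} here = cong suc (cong ∣_∣ (sym (p─⊥≡p p)))
x∈p⇒∣p∣≡1+∣p-x∣ {p = inside ∷ p}  (there x∈p) = cong suc (x∈p⇒∣p∣≡1+∣p-x∣ x∈p)
x∈p⇒∣p∣≡1+∣p-x∣ {p = outside ∷ p} (there x∈p) = x∈p⇒∣p∣≡1+∣p-x∣ x∈p

x∉p⇒∣p∪⁅x⁆∣≡1+∣p∣ : x ∉ p → ∣ p ∪ ⁅ x ⁆ ∣ ≡ suc ∣ p ∣
x∉p⇒∣p∪⁅x⁆∣≡1+∣p∣ {x = zero}  {p = inside ∷ p}  x∉p = contradiction here x∉p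
x∉p⇒∣p∪⁅x⁆∣≡1+∣p∣ {x = zero}  {p = outside ∷ p} x∉p = cong suc (cong ∣_∣ (∪-identityʳ p))
x∉p⇒∣p∪⁅x⁆∣≡1+∣p∣ {x = suc x} {p = inside ∷ p}  x∉p = cong suc (x∉p⇒∣p∪⁅x⁆∣≡1+∣p∣ (x∉p ∘ there))
x∉p⇒∣p∪⁅x⁆∣≡1+∣p∣ {x = suc x} {p = outside ∷ p} x∉p = x∉p⇒∣p∪⁅x⁆∣≡1+∣p∣ (x∉p ∘ there)

0<∣p∣⇒Nonempty : 0 < ∣ p ∣ → Nonempty p
0<∣p∣⇒Nonempty {p = inside ∷ p}  _ = zero , here
0<∣p∣⇒Nonempty {p = outside ∷ p} 0<∣p∣ with 0<∣p∣⇒Nonempty 0<∣p∣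
... | x , x∈p = suc x , there x∈p

x∈p⇒0<∣p∣ : x ∈ p → 0 < ∣ p ∣
x∈p⇒0<∣p∣ x∈p = subst (0 <_) (sym (x∈p⇒∣p∣≡1+∣p-x∣ x∈p)) (s≤s z≤n)

Empty⇒∣p∣≡0 : Empty p → ∣ p ∣ ≡ 0
Empty⇒∣p∣≡0 {n} p≡∅ = trans (cong ∣_∣ (Empty-unique p≡∅)) (∣⊥∣≡0 n)

∣p∣<∣q∣⇒∃x∈q∉p : ∣ p ∣ < ∣ q ∣ → ∃ λ x → x ∈ q × x ∉ p
∣p∣<∣q∣⇒∃x∈q∉p {p = p} {q = q} ∣p∣<∣q∣ with nonempty? (q ─ p)
... | yes (x , x∈q─p) = x , p─q⊆p q p x∈q─p , x∈p─q⇒x∉q q p x∈q─p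
... | no  q─p≡∅       = contradiction ∣p∣<∣q∣ (≤⇒≯ (begin
  ∣ q ∣                 ≡⟨ ∣p∣≡∣p∩q∣+∣p─q∣ q p ⟩
  ∣ q ∩ p ∣ + ∣ q ─ p ∣ ≡⟨ cong (∣ q ∩ p ∣ +_) (Empty⇒∣p∣≡0 q─p≡∅) ⟩
  ∣ q ∩ p ∣ + 0         ≡⟨ +-identityʳ _ ⟩
  ∣ q ∩ p ∣             ≤⟨ ∣p∩q∣≤∣q∣ q p ⟩
  ∣ p ∣                 ∎))
  where open ℕ.≤-Reasoning

p⊆q∧∣q∣≤∣p∣⇒p≡q : p ⊆ q → ∣ q ∣ ≤ ∣ p ∣ → p ≡ q
p⊆q∧∣q∣≤∣p∣⇒p≡q {p = p} {q = q} p⊆q ∣q∣≤∣p∣ = ⊆-antisym p⊆q q⊆p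
  where
  q⊆p : q ⊆ p
  q⊆p {x} x∈q with x ∈? p
  ... | yes x∈p = x∈p
  ... | no  x∉p = contradiction ∣q∣≤∣p∣ (<⇒≱ (p⊂q⇒∣p∣<∣q∣ (p⊆q , x , x∈q , x∉p)))

∣p∣≤1∧x∈p∧y∈p⇒x≡y : ∣ p ∣ ≤ 1 → x ∈ p → y ∈ p → x ≡ y
∣p∣≤1∧x∈p∧y∈p⇒x≡y {p = p} {x = x} {y = y} ∣p∣≤1 x∈p y∈p with y ≟ x
... | yes y≡x = sym y≡x
... | no  y≢x = contradiction ∣p∣≤1 (<⇒≱ (begin-strict
  1              <⟨ s≤s (x∈p⇒0<∣p∣ (x∈p∧x≢y⇒x∈p-y y∈p y≢x)) ⟩
  suc ∣ p - x ∣  ≡⟨ x∈p⇒∣p∣≡1+∣p-x∣ x∈p ⟨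
  ∣ p ∣          ∎))
  where open ℕ.≤-Reasoning

record Injection (p q : Subset n) : Set where
  field
    map       : ∀ {x} → x ∈ p → Fin n
    map∈q     : ∀ {x} (x∈p : x ∈ p) → map x∈p ∈ q
    injective : ∀ {x y} (x∈p : x ∈ p) (y∈p : y ∈ p) → map x∈p ≡ map y∈p → x ≡ y

Injection-remove : (f : Injection p q) (x∈p : x ∈ p) → Injection (p - x) (q - Injection.map f x∈p)
Injection-remove {p = p} {x = x} f x∈p = record
  { map       = map ∘ ∈p
  ; map∈q     = λ y∈ → x∈p∧x≢y⇒x∈p-y (map∈q (∈p y∈)) (x∈p-y⇒x≢y p y∈ ∘ injective (∈p y∈) x∈p)
  ; injective = λ y∈ z∈ → injective (∈p y∈) (∈p z∈)
  }
  where
  open Injection f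
  ∈p : ∀ {y} → y ∈ p - x → y ∈ p
  ∈p = p─q⊆p p ⁅ x ⁆

Injection⇒∣p∣≤∣q∣ : Injection p q → ∣ p ∣ ≤ ∣ q ∣
Injection⇒∣p∣≤∣q∣ {n} = go _ refl
  where
  go : ∀ m {p q : Subset n} → ∣ p ∣ ≡ m → Injection p q → m ≤ ∣ q ∣
  go zero    _        _ = z≤n
  go (suc m) {p} {q} ∣p∣≡1+m f with 0<∣p∣⇒Nonempty (subst (0 <_) (sym ∣p∣≡1+m) (s≤s z≤n))
  ... | x , x∈p = begin
    suc m                              ≤⟨ s≤s (go m ∣p-x∣≡m (Injection-remove f x∈p)) ⟩
    suc ∣ q - Injection.map f x∈p ∣    ≡⟨ x∈p⇒∣p∣≡1+∣p-x∣ (Injection.map∈q f x∈p) ⟨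
    ∣ q ∣                              ∎
    where
    open ℕ.≤-Reasoning
    ∣p-x∣≡m : ∣ p - x ∣ ≡ m
    ∣p-x∣≡m = suc-injective (trans (sym (x∈p⇒∣p∣≡1+∣p-x∣ x∈p)) ∣p∣≡1+m)

-- For sets of equal size k, Close means equal or adjacent in J(n,k) (see ≈⇒~⊎≡).
Close : Subset n → Subset n → Set
Close p q = ∣ p ─ q ∣ ≤ 1

q⊆p⇒∣p∣≡∣q∣+∣p─q∣ : q ⊆ p → ∣ p ∣ ≡ ∣ q ∣ + ∣ p ─ q ∣
q⊆p⇒∣p∣≡∣q∣+∣p─q∣ {q = q} {p = p} q⊆p =
  trans (∣p∣≡∣p∩q∣+∣p─q∣ p q) (cong (λ s → ∣ s ∣ + ∣ p ─ q ∣) p∩q≡q)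
  where
  p∩q≡q : p ∩ q ≡ q
  p∩q≡q = ⊆-antisym (p∩q⊆q p q) (λ x∈q → x∈p∩q⁺ (q⊆p x∈q , x∈q))

∣p∣≡∣q∣⇒∣p─q∣≡∣q─p∣ : ∀ (p q : Subset n) → ∣ p ∣ ≡ ∣ q ∣ → ∣ p ─ q ∣ ≡ ∣ q ─ p ∣
∣p∣≡∣q∣⇒∣p─q∣≡∣q─p∣ p q ∣p∣≡∣q∣ = +-cancelˡ-≡ ∣ p ∩ q ∣ _ _ (begin
  ∣ p ∩ q ∣ + ∣ p ─ q ∣ ≡⟨ ∣p∣≡∣p∩q∣+∣p─q∣ p q ⟨
  ∣ p ∣                 ≡⟨ ∣p∣≡∣q∣ ⟩
  ∣ q ∣                 ≡⟨ ∣p∣≡∣p∩q∣+∣p─q∣ q p ⟩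
  ∣ q ∩ p ∣ + ∣ q ─ p ∣ ≡⟨ cong (λ s → ∣ s ∣ + ∣ q ─ p ∣) (∩-comm q p) ⟩
  ∣ p ∩ q ∣ + ∣ q ─ p ∣ ∎)
  where open ≡-Reasoning

Close∧x∈p∧x∉q⇒p-x⊆q : Close p q → x ∈ p → x ∉ q → p - x ⊆ q
Close∧x∈p∧x∉q⇒p-x⊆q {p = p} {q = q} {x = x} close x∈p x∉q {y} y∈p-x with y ∈? q
... | yes y∈q = y∈q
... | no  y∉q = contradiction
      (∣p∣≤1∧x∈p∧y∈p⇒x≡y close (x∈p∧x∉q⇒x∈p─q (p─q⊆p p ⁅ x ⁆ y∈p-x) y∉q) (x∈p∧x∉q⇒x∈p─q x∈p x∉q))
      (x∈p-y⇒x≢y p y∈p-x)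

⊇-common⇒Close : ∣ p ∣ ≡ suc ∣ r ∣ → r ⊆ p → r ⊆ q → Close p q
⊇-common⇒Close {p = p} {r = r} {q = q} ∣p∣≡1+∣r∣ r⊆p r⊆q = begin
  ∣ p ─ q ∣ ≤⟨ p⊆q⇒∣p∣≤∣q∣ p─q⊆p─r ⟩
  ∣ p ─ r ∣ ≡⟨ +-cancelˡ-≡ ∣ r ∣ _ _ (trans (sym (q⊆p⇒∣p∣≡∣q∣+∣p─q∣ r⊆p)) (trans ∣p∣≡1+∣r∣ (+-comm 1 ∣ r ∣))) ⟩
  1         ∎
  where
  open ℕ.≤-Reasoning
  p─q⊆p─r : p ─ q ⊆ p ─ r
  p─q⊆p─r x∈p─q = x∈p∧x∉q⇒x∈p─q (p─q⊆p p q x∈p─q) (x∈p─q⇒x∉q p q x∈p─q ∘ r⊆q)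

⊆-common⇒Close : ∣ r ∣ ≡ suc ∣ q ∣ → p ⊆ r → q ⊆ r → Close p q
⊆-common⇒Close {r = r} {q = q} {p = p} ∣r∣≡1+∣q∣ p⊆r q⊆r = begin
  ∣ p ─ q ∣ ≤⟨ p⊆q⇒∣p∣≤∣q∣ p─q⊆r─q ⟩
  ∣ r ─ q ∣ ≡⟨ +-cancelˡ-≡ ∣ q ∣ _ _ (trans (sym (q⊆p⇒∣p∣≡∣q∣+∣p─q∣ q⊆r)) (trans ∣r∣≡1+∣q∣ (+-comm 1 ∣ q ∣))) ⟩
  1         ∎
  where
  open ℕ.≤-Reasoning
  p─q⊆r─q : p ─ q ⊆ r ─ q
  p─q⊆r─q x∈p─q = x∈p∧x∉q⇒x∈p─q (p⊆r (p─q⊆p p q x∈p─q)) (x∈p─q⇒x∉q p q x∈p─q)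

close-to-three⇒⊆∪ : ∀ {p q₁ q₂ q₃ : Subset n} → Close p q₁ → Close p q₂ → Close p q₃ →
                    2 + ∣ q₁ ∩ q₂ ∩ q₃ ∣ ≤ ∣ p ∣ → p ⊆ q₁ ∪ q₂ ∪ q₃
close-to-three⇒⊆∪ {p = p} {q₁} {q₂} {q₃} c₁ c₂ c₃ small {x} x∈p with x ∈? q₁ ∪ q₂ ∪ q₃
... | yes x∈∪ = x∈∪
... | no  x∉∪ = contradiction small (<⇒≱ (begin-strict
  ∣ p ∣                  ≡⟨ x∈p⇒∣p∣≡1+∣p-x∣ x∈p ⟩
  suc ∣ p - x ∣          ≤⟨ s≤s (p⊆q⇒∣p∣≤∣q∣ p-x⊆∩) ⟩
  suc ∣ q₁ ∩ q₂ ∩ q₃ ∣   <⟨ ℕ.n<1+n _ ⟩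
  2 + ∣ q₁ ∩ q₂ ∩ q₃ ∣   ∎))
  where
  open ℕ.≤-Reasoning
  x∉q₁ : x ∉ q₁
  x∉q₁ = x∉∪ ∘ x∈p∪q⁺ ∘ inj₁
  x∉q₂ : x ∉ q₂
  x∉q₂ = x∉∪ ∘ x∈p∪q⁺ ∘ inj₂ ∘ x∈p∪q⁺ ∘ inj₁
  x∉q₃ : x ∉ q₃
  x∉q₃ = x∉∪ ∘ x∈p∪q⁺ ∘ inj₂ ∘ x∈p∪q⁺ ∘ inj₂
  p-x⊆∩ : p - x ⊆ q₁ ∩ q₂ ∩ q₃
  p-x⊆∩ y∈ = x∈p∩q⁺ (Close∧x∈p∧x∉q⇒p-x⊆q c₁ x∈p x∉q₁ y∈ ,
             x∈p∩q⁺ (Close∧x∈p∧x∉q⇒p-x⊆q c₂ x∈p x∉q₂ y∈ , Close∧x∈p∧x∉q⇒p-x⊆q c₃ x∈p x∉q₃ y∈))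

close-from-three⇒∩⊆ : ∀ {p q₁ q₂ q₃ : Subset n} → Close q₁ p → Close q₂ p → Close q₃ p →
                      2 + ∣ p ∣ ≤ ∣ q₁ ∪ q₂ ∪ q₃ ∣ → q₁ ∩ q₂ ∩ q₃ ⊆ p
close-from-three⇒∩⊆ {p = p} {q₁} {q₂} {q₃} c₁ c₂ c₃ large {x} x∈∩ with x ∈? p
... | yes x∈p = x∈p
... | no  x∉p = contradiction large (<⇒≱ (begin-strict
  ∣ q₁ ∪ q₂ ∪ q₃ ∣         ≡⟨ x∈p⇒∣p∣≡1+∣p-x∣ x∈∪ ⟩
  suc ∣ q₁ ∪ q₂ ∪ q₃ - x ∣ ≤⟨ s≤s (p⊆q⇒∣p∣≤∣q∣ ∪-x⊆p) ⟩
  suc ∣ p ∣                <⟨ ℕ.n<1+n _ ⟩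
  2 + ∣ p ∣                ∎))
  where
  open ℕ.≤-Reasoning
  x∈q₁ : x ∈ q₁
  x∈q₁ = proj₁ (x∈p∩q⁻ q₁ _ x∈∩)
  x∈q₂ : x ∈ q₂
  x∈q₂ = proj₁ (x∈p∩q⁻ q₂ _ (proj₂ (x∈p∩q⁻ q₁ _ x∈∩)))
  x∈q₃ : x ∈ q₃
  x∈q₃ = proj₂ (x∈p∩q⁻ q₂ _ (proj₂ (x∈p∩q⁻ q₁ _ x∈∩)))
  x∈∪ : x ∈ q₁ ∪ q₂ ∪ q₃
  x∈∪ = x∈p∪q⁺ (inj₁ x∈q₁)
  ∪-x⊆p : q₁ ∪ q₂ ∪ q₃ - x ⊆ p
  ∪-x⊆p {y} y∈ with x∈p∪q⁻ q₁ _ (p─q⊆p _ ⁅ x ⁆ y∈)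
  ... | inj₁ y∈q₁ = Close∧x∈p∧x∉q⇒p-x⊆q c₁ x∈q₁ x∉p (x∈p∧x≢y⇒x∈p-y y∈q₁ (x∈p-y⇒x≢y _ y∈))
  ... | inj₂ y∈q₂∪q₃ with x∈p∪q⁻ q₂ _ y∈q₂∪q₃
  ...   | inj₁ y∈q₂ = Close∧x∈p∧x∉q⇒p-x⊆q c₂ x∈q₂ x∉p (x∈p∧x≢y⇒x∈p-y y∈q₂ (x∈p-y⇒x≢y _ y∈))
  ...   | inj₂ y∈q₃ = Close∧x∈p∧x∉q⇒p-x⊆q c₃ x∈q₃ x∉p (x∈p∧x≢y⇒x∈p-y y∈q₃ (x∈p-y⇒x≢y _ y∈))

x∉p∧p∪⁅x⁆≡p∪⁅y⁆⇒x≡y : x ∉ p → p ∪ ⁅ x ⁆ ≡ p ∪ ⁅ y ⁆ → x ≡ y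
x∉p∧p∪⁅x⁆≡p∪⁅y⁆⇒x≡y {x = x} {p = p} {y = y} x∉p eq
  with x∈p∪q⁻ p ⁅ y ⁆ (subst (x ∈_) eq (x∈p∪q⁺ (inj₂ (x∈⁅x⁆ x))))
... | inj₁ x∈p    = contradiction x∈p x∉p
... | inj₂ x∈⁅y⁆ = x∈⁅y⁆⇒x≡y y x∈⁅y⁆

y∈p∧p-x≡p-y⇒x≡y : y ∈ p → p - x ≡ p - y → x ≡ y
y∈p∧p-x≡p-y⇒x≡y {y = y} {p = p} {x = x} y∈p eq with x ≟ y
... | yes x≡y = x≡y
... | no  x≢y = contradiction refl (x∈p-y⇒x≢y p (subst (y ∈_) eq (x∈p∧x≢y⇒x∈p-y y∈p (x≢y ∘ sym))))

p⊆q∧x∉p⇒p≡q-x : ∣ q ∣ ≡ suc ∣ p ∣ → p ⊆ q → x ∈ q → x ∉ p → p ≡ q - x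
p⊆q∧x∉p⇒p≡q-x {q = q} {p = p} {x = x} ∣q∣≡1+∣p∣ p⊆q x∈q x∉p =
  p⊆q∧∣q∣≤∣p∣⇒p≡q p⊆q-x (≤-reflexive (suc-injective (trans (sym (x∈p⇒∣p∣≡1+∣p-x∣ x∈q)) ∣q∣≡1+∣p∣)))
  where
  p⊆q-x : p ⊆ q - x
  p⊆q-x y∈p = x∈p∧x≢y⇒x∈p-y (p⊆q y∈p) (λ { refl → x∉p y∈p })

q⊆p∧x∈p⇒q∪⁅x⁆≡p : ∣ p ∣ ≡ suc ∣ q ∣ → q ⊆ p → x ∈ p → x ∉ q → q ∪ ⁅ x ⁆ ≡ p
q⊆p∧x∈p⇒q∪⁅x⁆≡p {p = p} {q = q} {x = x} ∣p∣≡1+∣q∣ q⊆p x∈p x∉q =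
  p⊆q∧∣q∣≤∣p∣⇒p≡q q∪⁅x⁆⊆p (≤-reflexive (trans ∣p∣≡1+∣q∣ (sym (x∉p⇒∣p∪⁅x⁆∣≡1+∣p∣ x∉q))))
  where
  q∪⁅x⁆⊆p : q ∪ ⁅ x ⁆ ⊆ p
  q∪⁅x⁆⊆p y∈ with x∈p∪q⁻ q ⁅ x ⁆ y∈
  ... | inj₁ y∈q    = q⊆p y∈q
  ... | inj₂ y∈⁅x⁆ = subst (_∈ p) (sym (x∈⁅y⁆⇒x≡y x y∈⁅x⁆)) x∈p

exchange : Subset n → Fin n → Fin n → Subset n
exchange p x y = (p - x) ∪ ⁅ y ⁆

record Exchange (new old : Subset n) : Set where
  field
    removed         : Fin n
    added           : Fin n
    removed∈old     : removed ∈ old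
    removed∉new     : removed ∉ new
    added∈new       : added ∈ new
    added∉old       : added ∉ old
    old-removed⊆new : old - removed ⊆ new
    new⊆old∪added   : new ⊆ old ∪ ⁅ added ⁆

exchange-Exchange : x ∈ p → y ∉ p → Exchange (exchange p x y) p
exchange-Exchange {x = x} {p = p} {y = y} x∈p y∉p = record
  { removed         = x
  ; added           = y
  ; removed∈old     = x∈p
  ; removed∉new     = x∉exchange
  ; added∈new       = x∈p∪q⁺ (inj₂ (x∈⁅x⁆ y))
  ; added∉old       = y∉p
  ; old-removed⊆new = x∈p∪q⁺ ∘ inj₁
  ; new⊆old∪added   = exchange⊆p∪⁅y⁆
  }
  where
  x∉exchange : x ∉ exchange p x y
  x∉exchange x∈ with x∈p∪q⁻ (p - x) ⁅ y ⁆ x∈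
  ... | inj₁ x∈p-x  = x∈p-y⇒x≢y p x∈p-x refl
  ... | inj₂ x∈⁅y⁆ = y∉p (subst (_∈ p) (x∈⁅y⁆⇒x≡y y x∈⁅y⁆) x∈p)
  exchange⊆p∪⁅y⁆ : exchange p x y ⊆ p ∪ ⁅ y ⁆
  exchange⊆p∪⁅y⁆ z∈ with x∈p∪q⁻ (p - x) ⁅ y ⁆ z∈
  ... | inj₁ z∈p-x  = x∈p∪q⁺ (inj₁ (p─q⊆p p ⁅ x ⁆ z∈p-x))
  ... | inj₂ z∈⁅y⁆ = x∈p∪q⁺ (inj₂ z∈⁅y⁆)

∣exchange∣≡∣p∣ : x ∈ p → y ∉ p → ∣ exchange p x y ∣ ≡ ∣ p ∣
∣exchange∣≡∣p∣ {x = x} {p = p} x∈p y∉p =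
  trans (x∉p⇒∣p∪⁅x⁆∣≡1+∣p∣ (y∉p ∘ p─q⊆p p ⁅ x ⁆)) (sym (x∈p⇒∣p∣≡1+∣p-x∣ x∈p))

∣∁p∣+∣p∣≡n : ∀ (p : Subset n) → ∣ ∁ p ∣ + ∣ p ∣ ≡ n
∣∁p∣+∣p∣≡n p = trans (cong (_+ ∣ p ∣) (∣∁p∣≡n∸∣p∣ p)) (ℕ.m∸n+n≡m (∣p∣≤n p))

∣p─p∣≡0 : ∀ (p : Subset n) → ∣ p ─ p ∣ ≡ 0
∣p─p∣≡0 []            = refl
∣p─p∣≡0 (inside ∷ p)  = ∣p─p∣≡0 p
∣p─p∣≡0 (outside ∷ p) = ∣p─p∣≡0 p

x∉p∧x≢y⇒x∉p∪⁅y⁆ : x ∉ p → x ≢ y → x ∉ p ∪ ⁅ y ⁆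
x∉p∧x≢y⇒x∉p∪⁅y⁆ {p = p} {y = y} x∉p x≢y x∈ with x∈p∪q⁻ p ⁅ y ⁆ x∈
... | inj₁ x∈p    = x∉p x∈p
... | inj₂ x∈⁅y⁆ = x≢y (x∈⁅y⁆⇒x≡y y x∈⁅y⁆)

p-x⊆q⇒p⊆q∪⁅x⁆ : p - x ⊆ q → p ⊆ q ∪ ⁅ x ⁆
p-x⊆q⇒p⊆q∪⁅x⁆ {x = x} p-x⊆q {y} y∈p with y ≟ x
... | yes refl = x∈p∪q⁺ (inj₂ (x∈⁅x⁆ x))
... | no  y≢x  = x∈p∪q⁺ (inj₁ (p-x⊆q (x∈p∧x≢y⇒x∈p-y y∈p y≢x)))

module JohnsonGraph (n k : ℕ) where

  Vertex : Set
  Vertex = Vtx (Johnson n k)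

  _~_ : Vertex → Vertex → Set
  _~_ = Adj (Johnson n k)

  _≈_ : Vertex → Vertex → Set
  u ≈ v = Close (proj₁ u) (proj₁ v)

  private variable
    u v : Vertex

  proj₁-injective : proj₁ u ≡ proj₁ v → u ≡ v
  proj₁-injective {_ , ∣u∣≡k} {_ , ∣v∣≡k} refl = cong (_ ,_) (ℕ.≡-irrelevant ∣u∣≡k ∣v∣≡k)

  ~⇒∣─∣≡1 : u ~ v → ∣ proj₁ u ─ proj₁ v ∣ ≡ 1
  ~⇒∣─∣≡1 {A , ∣A∣≡k} {B , _} u~v = +-cancelˡ-≡ ∣ A ∩ B ∣ _ _ (begin
    ∣ A ∩ B ∣ + ∣ A ─ B ∣ ≡⟨ ∣p∣≡∣p∩q∣+∣p─q∣ A B ⟨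
    ∣ A ∣                 ≡⟨ trans ∣A∣≡k (sym u~v) ⟩
    ∣ A ∩ B ∣ + 1         ∎)
    where open ≡-Reasoning

  ~⇒≈ : u ~ v → u ≈ v
  ~⇒≈ {u} {v} u~v = ≤-reflexive (~⇒∣─∣≡1 {u} {v} u~v)

  ~-sym : u ~ v → v ~ u
  ~-sym {A , _} {B , _} = subst (λ s → ∣ s ∣ + 1 ≡ k) (∩-comm A B)

  ∣─∣-sym : ∣ proj₁ u ─ proj₁ v ∣ ≡ ∣ proj₁ v ─ proj₁ u ∣
  ∣─∣-sym {A , ∣A∣≡k} {B , ∣B∣≡k} = ∣p∣≡∣q∣⇒∣p─q∣≡∣q─p∣ A B (trans ∣A∣≡k (sym ∣B∣≡k))

  ≈⇒~⊎≡ : u ≈ v → u ~ v ⊎ u ≡ v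
  ≈⇒~⊎≡ {A , ∣A∣≡k} {B , ∣B∣≡k} u≈v with n≤1⇒n≡0∨n≡1 u≈v
  ... | inj₂ ∣A─B∣≡1 = inj₁ (begin
    ∣ A ∩ B ∣ + 1         ≡⟨ cong (∣ A ∩ B ∣ +_) ∣A─B∣≡1 ⟨
    ∣ A ∩ B ∣ + ∣ A ─ B ∣ ≡⟨ ∣p∣≡∣p∩q∣+∣p─q∣ A B ⟨
    ∣ A ∣                 ≡⟨ ∣A∣≡k ⟩
    k                     ∎)
    where open ≡-Reasoning
  ... | inj₁ ∣A─B∣≡0 = inj₂ (proj₁-injective (p⊆q∧∣q∣≤∣p∣⇒p≡q A⊆B (≤-reflexive (trans ∣B∣≡k (sym ∣A∣≡k)))))
    where
    A⊆B : A ⊆ B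
    A⊆B {x} x∈A with x ∈? B
    ... | yes x∈B = x∈B
    ... | no  x∉B = contradiction (≤-reflexive ∣A─B∣≡0) (<⇒≱ (x∈p⇒0<∣p∣ (x∈p∧x∉q⇒x∈p─q x∈A x∉B)))

  ⊇-common⇒≈ : ∀ {Z : Subset n} → suc ∣ Z ∣ ≡ k → Z ⊆ proj₁ u → Z ⊆ proj₁ v → u ≈ v
  ⊇-common⇒≈ {_ , ∣A∣≡k} ∣Z∣+1≡k = ⊇-common⇒Close (trans ∣A∣≡k (sym ∣Z∣+1≡k))

  ⊆-common⇒≈ : ∀ {W : Subset n} → ∣ W ∣ ≡ suc k → proj₁ u ⊆ W → proj₁ v ⊆ W → u ≈ v
  ⊆-common⇒≈ {v = _ , ∣B∣≡k} ∣W∣≡k+1 = ⊆-common⇒Close (trans ∣W∣≡k+1 (cong suc (sym ∣B∣≡k)))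

  ≈-refl : u ≈ u
  ≈-refl {A , _} = subst (_≤ 1) (sym (∣p─p∣≡0 A)) z≤n

  ≈∧∈∉⇒~ : u ≈ v → x ∈ proj₁ u → x ∉ proj₁ v → u ~ v
  ≈∧∈∉⇒~ {u} {v} u≈v x∈A x∉B with ≈⇒~⊎≡ {u} {v} u≈v
  ... | inj₁ u~v  = u~v
  ... | inj₂ refl = contradiction x∈A x∉B

  ~⇒∃∈∉ : u ~ v → ∃ λ x → x ∈ proj₁ u × x ∉ proj₁ v
  ~⇒∃∈∉ {u@(A , _)} {v@(B , _)} u~v
    with 0<∣p∣⇒Nonempty (subst (0 <_) (sym (~⇒∣─∣≡1 {u} {v} u~v)) (s≤s z≤n))
  ... | x , x∈A─B = x , p─q⊆p A B x∈A─B , x∈p─q⇒x∉q A B x∈A─B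

  ~⇒Exchange : u ~ v → Exchange (proj₁ u) (proj₁ v)
  ~⇒Exchange {u} {v} u~v with ~⇒∃∈∉ {v} {u} (~-sym {u} {v} u~v) | ~⇒∃∈∉ {u} {v} u~v
  ... | x , x∈B , x∉A | y , y∈A , y∉B = record
    { removed         = x
    ; added           = y
    ; removed∈old     = x∈B
    ; removed∉new     = x∉A
    ; added∈new       = y∈A
    ; added∉old       = y∉B
    ; old-removed⊆new = Close∧x∈p∧x∉q⇒p-x⊆q (~⇒≈ {v} {u} (~-sym {u} {v} u~v)) x∈B x∉A
    ; new⊆old∪added   = p-x⊆q⇒p⊆q∪⁅x⁆ (Close∧x∈p∧x∉q⇒p-x⊆q (~⇒≈ {u} {v} u~v) y∈A y∉B)
    }

  exchangeᵛ : (u : Vertex) → x ∈ proj₁ u → y ∉ proj₁ u → Vertex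
  exchangeᵛ {x} {y} (A , ∣A∣≡k) x∈A y∉A = exchange A x y , trans (∣exchange∣≡∣p∣ x∈A y∉A) ∣A∣≡k

  exchange-toward : Nonempty (proj₁ u ─ proj₁ v) →
                    ∃ λ c → c ~ u × ∣ proj₁ c ─ proj₁ v ∣ < ∣ proj₁ u ─ proj₁ v ∣
  exchange-toward {u@(A , ∣A∣≡k)} {v@(B , _)} (x , x∈A─B)
    with 0<∣p∣⇒Nonempty (subst (0 <_) (∣─∣-sym {u} {v}) (x∈p⇒0<∣p∣ x∈A─B))
  ... | y , y∈B─A = c , c~u , ≤-<-trans (p⊆q⇒∣p∣≤∣q∣ C─B⊆[A─B]-x) (x∈p⇒∣p-x∣<∣p∣ x∈A─B)
    where
    x∈A : x ∈ A
    x∈A = p─q⊆p A B x∈A─B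
    y∈B : y ∈ B
    y∈B = p─q⊆p B A y∈B─A
    y∉A : y ∉ A
    y∉A = x∈p─q⇒x∉q B A y∈B─A
    c : Vertex
    c = exchangeᵛ u x∈A y∉A
    open Exchange (exchange-Exchange x∈A y∉A)
    c~u : c ~ u
    c~u = ≈∧∈∉⇒~ {c} {u}
      (⊇-common⇒≈ {c} {u} (trans (sym (x∈p⇒∣p∣≡1+∣p-x∣ x∈A)) ∣A∣≡k) old-removed⊆new (p─q⊆p A ⁅ x ⁆))
      added∈new y∉A
    C─B⊆[A─B]-x : exchange A x y ─ B ⊆ (A ─ B) - x
    C─B⊆[A─B]-x {z} z∈C─B with x∈p∪q⁻ A ⁅ y ⁆ (new⊆old∪added (p─q⊆p _ B z∈C─B))
    ... | inj₁ z∈A    = x∈p∧x≢y⇒x∈p-y (x∈p∧x∉q⇒x∈p─q z∈A (x∈p─q⇒x∉q _ B z∈C─B))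
                                     (λ { refl → removed∉new (p─q⊆p _ B z∈C─B) })
    ... | inj₂ z∈⁅y⁆ = contradiction (subst (_∈ B) (sym (x∈⁅y⁆⇒x≡y y z∈⁅y⁆)) y∈B) (x∈p─q⇒x∉q _ B z∈C─B)

  crossing-edge : (P : Pred Vertex 0ℓ) → Decidable P → P v → ¬ P u → ∃₂ λ u w → u ~ w × P u × ¬ P w
  crossing-edge {v} {u} P P? Pv ¬Pu = go u (<-wellFounded _) ¬Pu
    where
    go : ∀ u → Acc _<_ ∣ proj₁ u ─ proj₁ v ∣ → ¬ P u → ∃₂ λ u w → u ~ w × P u × ¬ P w
    go u (acc closer) ¬Pu with nonempty? (proj₁ u ─ proj₁ v)
    ... | yes U─V≢∅ with exchange-toward {u} {v} U─V≢∅
    ...   | c , c~u , c-closer with P? c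
    ...     | yes Pc  = c , u , c~u , Pc , ¬Pu
    ...     | no  ¬Pc = go c (closer c-closer) ¬Pc
    go u _ ¬Pu | no U─V≡∅ with ≈⇒~⊎≡ {u} {v} (subst (_≤ 1) (sym (Empty⇒∣p∣≡0 U─V≡∅)) z≤n)
    ... | inj₁ u~v  = v , u , ~-sym {u} {v} u~v , Pv , ¬Pu
    ... | inj₂ refl = contradiction Pv ¬Pu

  module _ (ψ : Vertex → Vertex) (ψ-injective : ∀ {u v} → ψ u ≡ ψ v → u ≡ v)
           (ψ-~ : ∀ {u v} → u ~ v → ψ u ~ ψ v) where

    ψ-≈ : u ≈ v → ψ u ≈ ψ v
    ψ-≈ {u} {v} u≈v with ≈⇒~⊎≡ {u} {v} u≈v
    ... | inj₁ u~v  = ~⇒≈ {ψ u} {ψ v} (ψ-~ u~v)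
    ... | inj₂ refl = ≈-refl {ψ u}

    -- The maximal cliques of J(n,k): the star of a (k-1)-set Z, the k-sets containing Z
    -- (indexed by ∁ Z), and the top of a (k+1)-set W, the k-subsets of W (indexed by W).
    maps-star-into-top⇒∣∁Z∣≤∣W∣ : ∀ {Z W : Subset n} → suc ∣ Z ∣ ≡ k → ∣ W ∣ ≡ suc k →
                                  (∀ c → Z ⊆ proj₁ c → proj₁ (ψ c) ⊆ W) → ∣ ∁ Z ∣ ≤ ∣ W ∣
    maps-star-into-top⇒∣∁Z∣≤∣W∣ {Z} {W} ∣Z∣+1≡k ∣W∣≡k+1 into =
      Injection⇒∣p∣≤∣q∣ (record
        { map = missing ; map∈q = proj₁ ∘ proj₂ ∘ gap ; injective = missing-injective })
      where
      leaf : ∀ {z} → z ∈ ∁ Z → Vertex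
      leaf z∈ = Z ∪ ⁅ _ ⁆ , trans (x∉p⇒∣p∪⁅x⁆∣≡1+∣p∣ (x∈∁p⇒x∉p z∈)) ∣Z∣+1≡k
      image : ∀ {z} → z ∈ ∁ Z → Subset n
      image z∈ = proj₁ (ψ (leaf z∈))
      gap : ∀ {z} (z∈ : z ∈ ∁ Z) → ∃ λ w → w ∈ W × w ∉ image z∈
      gap z∈ = ∣p∣<∣q∣⇒∃x∈q∉p (subst₂ _<_ (sym (proj₂ (ψ (leaf z∈)))) (sym ∣W∣≡k+1) (ℕ.n<1+n k))
      missing : ∀ {z} → z ∈ ∁ Z → Fin n
      missing z∈ = proj₁ (gap z∈)
      image≡W-missing : ∀ {z} (z∈ : z ∈ ∁ Z) → image z∈ ≡ W - missing z∈
      image≡W-missing z∈ = p⊆q∧x∉p⇒p≡q-x (trans ∣W∣≡k+1 (cong suc (sym (proj₂ (ψ (leaf z∈))))))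
        (into (leaf z∈) (p⊆p∪q ⁅ _ ⁆)) (proj₁ (proj₂ (gap z∈))) (proj₂ (proj₂ (gap z∈)))
      missing-injective : ∀ {z z′} (z∈ : z ∈ ∁ Z) (z′∈ : z′ ∈ ∁ Z) → missing z∈ ≡ missing z′∈ → z ≡ z′
      missing-injective z∈ z′∈ eq = x∉p∧p∪⁅x⁆≡p∪⁅y⁆⇒x≡y (x∈∁p⇒x∉p z∈)
        (cong proj₁ (ψ-injective (proj₁-injective (begin
          image z∈         ≡⟨ image≡W-missing z∈ ⟩
          W - missing z∈   ≡⟨ cong (W -_) eq ⟩
          W - missing z′∈  ≡⟨ image≡W-missing z′∈ ⟨
          image z′∈        ∎))))
        where open ≡-Reasoning

    maps-top-into-star⇒∣W∣≤∣∁Z∣ : ∀ {Z W : Subset n} → suc ∣ Z ∣ ≡ k → ∣ W ∣ ≡ suc k →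
                                  (∀ c → proj₁ c ⊆ W → Z ⊆ proj₁ (ψ c)) → ∣ W ∣ ≤ ∣ ∁ Z ∣
    maps-top-into-star⇒∣W∣≤∣∁Z∣ {Z} {W} ∣Z∣+1≡k ∣W∣≡k+1 into =
      Injection⇒∣p∣≤∣q∣ (record
        { map = extra ; map∈q = x∉p⇒x∈∁p ∘ proj₂ ∘ proj₂ ∘ gap ; injective = extra-injective })
      where
      facet : ∀ {w} → w ∈ W → Vertex
      facet w∈ = W - _ , suc-injective (trans (sym (x∈p⇒∣p∣≡1+∣p-x∣ w∈)) ∣W∣≡k+1)
      image : ∀ {w} → w ∈ W → Subset n
      image w∈ = proj₁ (ψ (facet w∈))
      gap : ∀ {w} (w∈ : w ∈ W) → ∃ λ z → z ∈ image w∈ × z ∉ Z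
      gap w∈ = ∣p∣<∣q∣⇒∃x∈q∉p (subst (∣ Z ∣ <_) (sym (proj₂ (ψ (facet w∈)))) (≤-reflexive ∣Z∣+1≡k))
      extra : ∀ {w} → w ∈ W → Fin n
      extra w∈ = proj₁ (gap w∈)
      Z+extra≡image : ∀ {w} (w∈ : w ∈ W) → Z ∪ ⁅ extra w∈ ⁆ ≡ image w∈
      Z+extra≡image w∈ = q⊆p∧x∈p⇒q∪⁅x⁆≡p (trans (proj₂ (ψ (facet w∈))) (sym ∣Z∣+1≡k))
        (into (facet w∈) (p─q⊆p W ⁅ _ ⁆)) (proj₁ (proj₂ (gap w∈))) (proj₂ (proj₂ (gap w∈)))
      extra-injective : ∀ {w w′} (w∈ : w ∈ W) (w′∈ : w′ ∈ W) → extra w∈ ≡ extra w′∈ → w ≡ w′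
      extra-injective w∈ w′∈ eq = y∈p∧p-x≡p-y⇒x≡y w′∈
        (cong proj₁ (ψ-injective (proj₁-injective (begin
          image w∈               ≡⟨ Z+extra≡image w∈ ⟨
          Z ∪ ⁅ extra w∈ ⁆       ≡⟨ cong (λ z → Z ∪ ⁅ z ⁆) eq ⟩
          Z ∪ ⁅ extra w′∈ ⁆      ≡⟨ Z+extra≡image w′∈ ⟩
          image w′∈              ∎))))
        where open ≡-Reasoning

    module Pivot {a s : Vertex} (a~s : a ~ s) (ψs≡s : ψ s ≡ s) (a≉ψa : ¬ (a ≈ ψ a))
                 (fixes-common : ∀ c → c ~ a → c ~ ψ a → ψ c ≡ c) where

      b : Vertex
      b = ψ a

      A S B : Subset n
      A = proj₁ a
      S = proj₁ s
      B = proj₁ b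

      b~s : b ~ s
      b~s = subst (b ~_) ψs≡s (ψ-~ {a} {s} a~s)

      module EA = Exchange (~⇒Exchange {a} {s} a~s)
      module EB = Exchange (~⇒Exchange {b} {s} b~s)

      -- a = s - a⁻ + a⁺ and b = s - b⁻ + b⁺.
      a⁻ a⁺ b⁻ b⁺ : Fin n
      a⁻ = EA.removed
      a⁺ = EA.added
      b⁻ = EB.removed
      b⁺ = EB.added

      ∣S-x∣+1≡k : x ∈ S → suc ∣ S - x ∣ ≡ k
      ∣S-x∣+1≡k x∈S = trans (sym (x∈p⇒∣p∣≡1+∣p-x∣ x∈S)) (proj₂ s)

      ∣S∪⁅x⁆∣≡k+1 : x ∉ S → ∣ S ∪ ⁅ x ⁆ ∣ ≡ suc k
      ∣S∪⁅x⁆∣≡k+1 x∉S = trans (x∉p⇒∣p∪⁅x⁆∣≡1+∣p∣ x∉S) (cong suc (proj₂ s))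

      b⁻≢a⁻ : b⁻ ≢ a⁻
      b⁻≢a⁻ b⁻≡a⁻ = a≉ψa (⊇-common⇒≈ {a} {b} (∣S-x∣+1≡k EA.removed∈old) EA.old-removed⊆new
                                     (subst (λ x → S - x ⊆ B) b⁻≡a⁻ EB.old-removed⊆new))

      a⁺≢b⁺ : a⁺ ≢ b⁺
      a⁺≢b⁺ a⁺≡b⁺ = a≉ψa (⊆-common⇒≈ {a} {b} (∣S∪⁅x⁆∣≡k+1 EA.added∉old) EA.new⊆old∪added
                                     (subst (λ x → B ⊆ S ∪ ⁅ x ⁆) (sym a⁺≡b⁺) EB.new⊆old∪added))

      s₂ s₃ : Vertex
      s₂ = exchangeᵛ s EA.removed∈old EB.added∉old
      s₃ = exchangeᵛ s EB.removed∈old EA.added∉old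

      S₂ S₃ : Subset n
      S₂ = proj₁ s₂
      S₃ = proj₁ s₃

      module E₂ = Exchange (exchange-Exchange {p = S} EA.removed∈old EB.added∉old)
      module E₃ = Exchange (exchange-Exchange {p = S} EB.removed∈old EA.added∉old)

      b⁺∉A : b⁺ ∉ A
      b⁺∉A = x∉p∧x≢y⇒x∉p∪⁅y⁆ EB.added∉old (a⁺≢b⁺ ∘ sym) ∘ EA.new⊆old∪added

      a⁺∉B : a⁺ ∉ B
      a⁺∉B = x∉p∧x≢y⇒x∉p∪⁅y⁆ EA.added∉old a⁺≢b⁺ ∘ EB.new⊆old∪added

      b⁻∈S₂ : b⁻ ∈ S₂
      b⁻∈S₂ = E₂.old-removed⊆new (x∈p∧x≢y⇒x∈p-y EB.removed∈old b⁻≢a⁻)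

      a⁻∈S₃ : a⁻ ∈ S₃
      a⁻∈S₃ = E₃.old-removed⊆new (x∈p∧x≢y⇒x∈p-y EA.removed∈old (b⁻≢a⁻ ∘ sym))

      s₂~a : s₂ ~ a
      s₂~a = ≈∧∈∉⇒~ {s₂} {a}
        (⊇-common⇒≈ {s₂} {a} (∣S-x∣+1≡k EA.removed∈old) E₂.old-removed⊆new EA.old-removed⊆new) E₂.added∈new b⁺∉A

      s₂~b : s₂ ~ b
      s₂~b = ≈∧∈∉⇒~ {s₂} {b}
        (⊆-common⇒≈ {s₂} {b} (∣S∪⁅x⁆∣≡k+1 EB.added∉old) E₂.new⊆old∪added EB.new⊆old∪added) b⁻∈S₂ EB.removed∉new

      s₃~a : s₃ ~ a
      s₃~a = ≈∧∈∉⇒~ {s₃} {a}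
        (⊆-common⇒≈ {s₃} {a} (∣S∪⁅x⁆∣≡k+1 EA.added∉old) E₃.new⊆old∪added EA.new⊆old∪added) a⁻∈S₃ EA.removed∉new

      s₃~b : s₃ ~ b
      s₃~b = ≈∧∈∉⇒~ {s₃} {b}
        (⊇-common⇒≈ {s₃} {b} (∣S-x∣+1≡k EB.removed∈old) E₃.old-removed⊆new EB.old-removed⊆new) E₃.added∈new a⁺∉B

      ψs₂≡s₂ : ψ s₂ ≡ s₂
      ψs₂≡s₂ = fixes-common s₂ s₂~a s₂~b

      ψs₃≡s₃ : ψ s₃ ≡ s₃
      ψs₃≡s₃ = fixes-common s₃ s₃~a s₃~b

      star[S-a⁻]↦top[S∪b⁺] : ∀ c → S - a⁻ ⊆ proj₁ c → proj₁ (ψ c) ⊆ S ∪ ⁅ b⁺ ⁆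
      star[S-a⁻]↦top[S∪b⁺] c S-a⁻⊆C =
        ⊆-trans (close-to-three⇒⊆∪ {p = proj₁ (ψ c)} ψc≈b ψc≈s ψc≈s₂ small) B∪S∪S₂⊆S∪b⁺
        where
        close : ∀ d → S - a⁻ ⊆ proj₁ d → c ≈ d
        close d = ⊇-common⇒≈ {c} {d} (∣S-x∣+1≡k EA.removed∈old) S-a⁻⊆C
        ψc≈b : ψ c ≈ b
        ψc≈b = ψ-≈ {c} {a} (close a EA.old-removed⊆new)
        ψc≈s : ψ c ≈ s
        ψc≈s = subst (ψ c ≈_) ψs≡s (ψ-≈ {c} {s} (close s (p─q⊆p S ⁅ a⁻ ⁆)))
        ψc≈s₂ : ψ c ≈ s₂
        ψc≈s₂ = subst (ψ c ≈_) ψs₂≡s₂ (ψ-≈ {c} {s₂} (close s₂ E₂.old-removed⊆new))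
        B∩S∩S₂⊆S-a⁻-b⁻ : B ∩ S ∩ S₂ ⊆ S - a⁻ - b⁻
        B∩S∩S₂⊆S-a⁻-b⁻ y∈ with x∈p∩q⁻ B _ y∈
        ... | y∈B , y∈S∩S₂ with x∈p∩q⁻ S S₂ y∈S∩S₂
        ...   | y∈S , y∈S₂ = x∈p∧x≢y⇒x∈p-y (x∈p∧x≢y⇒x∈p-y y∈S λ { refl → E₂.removed∉new y∈S₂ })
                                          λ { refl → EB.removed∉new y∈B }
        small : 2 + ∣ B ∩ S ∩ S₂ ∣ ≤ ∣ proj₁ (ψ c) ∣
        small = begin
          2 + ∣ B ∩ S ∩ S₂ ∣     ≤⟨ +-monoʳ-≤ 2 (p⊆q⇒∣p∣≤∣q∣ B∩S∩S₂⊆S-a⁻-b⁻) ⟩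
          2 + ∣ S - a⁻ - b⁻ ∣    ≡⟨ cong suc (x∈p⇒∣p∣≡1+∣p-x∣ (x∈p∧x≢y⇒x∈p-y EB.removed∈old b⁻≢a⁻)) ⟨
          suc ∣ S - a⁻ ∣         ≡⟨ ∣S-x∣+1≡k EA.removed∈old ⟩
          k                      ≡⟨ proj₂ (ψ c) ⟨
          ∣ proj₁ (ψ c) ∣        ∎
          where open ℕ.≤-Reasoning
        B∪S∪S₂⊆S∪b⁺ : B ∪ S ∪ S₂ ⊆ S ∪ ⁅ b⁺ ⁆
        B∪S∪S₂⊆S∪b⁺ y∈ with x∈p∪q⁻ B _ y∈
        ... | inj₁ y∈B = EB.new⊆old∪added y∈B
        ... | inj₂ y∈S∪S₂ with x∈p∪q⁻ S S₂ y∈S∪S₂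
        ...   | inj₁ y∈S  = p⊆p∪q ⁅ b⁺ ⁆ y∈S
        ...   | inj₂ y∈S₂ = E₂.new⊆old∪added y∈S₂

      top[S∪a⁺]↦star[S-b⁻] : ∀ c → proj₁ c ⊆ S ∪ ⁅ a⁺ ⁆ → S - b⁻ ⊆ proj₁ (ψ c)
      top[S∪a⁺]↦star[S-b⁻] c C⊆S∪a⁺ =
        ⊆-trans S-b⁻⊆B∩S∩S₃ (close-from-three⇒∩⊆ {p = proj₁ (ψ c)} b≈ψc s≈ψc s₃≈ψc large)
        where
        close : ∀ d → proj₁ d ⊆ S ∪ ⁅ a⁺ ⁆ → d ≈ c
        close d D⊆S∪a⁺ = ⊆-common⇒≈ {d} {c} (∣S∪⁅x⁆∣≡k+1 EA.added∉old) D⊆S∪a⁺ C⊆S∪a⁺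
        b≈ψc : b ≈ ψ c
        b≈ψc = ψ-≈ {a} {c} (close a EA.new⊆old∪added)
        s≈ψc : s ≈ ψ c
        s≈ψc = subst (_≈ ψ c) ψs≡s (ψ-≈ {s} {c} (close s (p⊆p∪q ⁅ a⁺ ⁆)))
        s₃≈ψc : s₃ ≈ ψ c
        s₃≈ψc = subst (_≈ ψ c) ψs₃≡s₃ (ψ-≈ {s₃} {c} (close s₃ E₃.new⊆old∪added))
        S-b⁻⊆B∩S∩S₃ : S - b⁻ ⊆ B ∩ S ∩ S₃
        S-b⁻⊆B∩S∩S₃ y∈ = x∈p∩q⁺ (EB.old-removed⊆new y∈ , x∈p∩q⁺ (p─q⊆p S ⁅ b⁻ ⁆ y∈ , E₃.old-removed⊆new y∈))
        S∪b⁺∪a⁺⊆B∪S∪S₃ : (S ∪ ⁅ b⁺ ⁆) ∪ ⁅ a⁺ ⁆ ⊆ B ∪ S ∪ S₃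
        S∪b⁺∪a⁺⊆B∪S∪S₃ {y} y∈ with x∈p∪q⁻ (S ∪ ⁅ b⁺ ⁆) ⁅ a⁺ ⁆ y∈
        ... | inj₂ y∈⁅a⁺⁆ =
          x∈p∪q⁺ (inj₂ (x∈p∪q⁺ (inj₂ (subst (_∈ S₃) (sym (x∈⁅y⁆⇒x≡y a⁺ y∈⁅a⁺⁆)) E₃.added∈new))))
        ... | inj₁ y∈S∪b⁺ with x∈p∪q⁻ S ⁅ b⁺ ⁆ y∈S∪b⁺
        ...   | inj₁ y∈S     = x∈p∪q⁺ (inj₂ (x∈p∪q⁺ (inj₁ y∈S)))
        ...   | inj₂ y∈⁅b⁺⁆ = x∈p∪q⁺ (inj₁ (subst (_∈ B) (sym (x∈⁅y⁆⇒x≡y b⁺ y∈⁅b⁺⁆)) EB.added∈new))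
        large : 2 + ∣ proj₁ (ψ c) ∣ ≤ ∣ B ∪ S ∪ S₃ ∣
        large = begin
          2 + ∣ proj₁ (ψ c) ∣          ≡⟨ cong (2 +_) (proj₂ (ψ c)) ⟩
          2 + k                        ≡⟨ cong suc (∣S∪⁅x⁆∣≡k+1 EB.added∉old) ⟨
          suc ∣ S ∪ ⁅ b⁺ ⁆ ∣           ≡⟨ x∉p⇒∣p∪⁅x⁆∣≡1+∣p∣ (x∉p∧x≢y⇒x∉p∪⁅y⁆ EA.added∉old a⁺≢b⁺) ⟨
          ∣ (S ∪ ⁅ b⁺ ⁆) ∪ ⁅ a⁺ ⁆ ∣    ≤⟨ p⊆q⇒∣p∣≤∣q∣ S∪b⁺∪a⁺⊆B∪S∪S₃ ⟩
          ∣ B ∪ S ∪ S₃ ∣               ∎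
          where open ℕ.≤-Reasoning

      ∣∁[S-a⁻]∣≤k+1 : ∣ ∁ (S - a⁻) ∣ ≤ suc k
      ∣∁[S-a⁻]∣≤k+1 = subst (∣ ∁ (S - a⁻) ∣ ≤_) (∣S∪⁅x⁆∣≡k+1 EB.added∉old)
        (maps-star-into-top⇒∣∁Z∣≤∣W∣ (∣S-x∣+1≡k EA.removed∈old) (∣S∪⁅x⁆∣≡k+1 EB.added∉old) star[S-a⁻]↦top[S∪b⁺])

      k+1≤∣∁[S-b⁻]∣ : suc k ≤ ∣ ∁ (S - b⁻) ∣
      k+1≤∣∁[S-b⁻]∣ = subst (_≤ ∣ ∁ (S - b⁻) ∣) (∣S∪⁅x⁆∣≡k+1 EA.added∉old)
        (maps-top-into-star⇒∣W∣≤∣∁Z∣ (∣S-x∣+1≡k EB.removed∈old) (∣S∪⁅x⁆∣≡k+1 EA.added∉old) top[S∪a⁺]↦star[S-b⁻])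

      ∣∁[S-a⁻]∣≡∣∁[S-b⁻]∣ : ∣ ∁ (S - a⁻) ∣ ≡ ∣ ∁ (S - b⁻) ∣
      ∣∁[S-a⁻]∣≡∣∁[S-b⁻]∣ = begin
        ∣ ∁ (S - a⁻) ∣   ≡⟨ ∣∁p∣≡n∸∣p∣ (S - a⁻) ⟩
        n ∸ ∣ S - a⁻ ∣   ≡⟨ cong (n ∸_) ∣S-a⁻∣≡∣S-b⁻∣ ⟩
        n ∸ ∣ S - b⁻ ∣   ≡⟨ ∣∁p∣≡n∸∣p∣ (S - b⁻) ⟨
        ∣ ∁ (S - b⁻) ∣   ∎
        where
        open ≡-Reasoning
        ∣S-a⁻∣≡∣S-b⁻∣ : ∣ S - a⁻ ∣ ≡ ∣ S - b⁻ ∣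
        ∣S-a⁻∣≡∣S-b⁻∣ = suc-injective (trans (∣S-x∣+1≡k EA.removed∈old) (sym (∣S-x∣+1≡k EB.removed∈old)))

      n≡2*k : n ≡ 2 * k
      n≡2*k = begin
        n                           ≡⟨ ∣∁p∣+∣p∣≡n (S - a⁻) ⟨
        ∣ ∁ (S - a⁻) ∣ + ∣ S - a⁻ ∣ ≡⟨ cong (_+ ∣ S - a⁻ ∣) ∣∁[S-a⁻]∣≡k+1 ⟩
        suc k + ∣ S - a⁻ ∣          ≡⟨ +-suc k _ ⟨
        k + suc ∣ S - a⁻ ∣          ≡⟨ cong (k +_) (∣S-x∣+1≡k EA.removed∈old) ⟩
        k + k                       ≡⟨ cong (k +_) (+-identityʳ k) ⟨
        2 * k                       ∎
        where
        open ≡-Reasoning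
        ∣∁[S-a⁻]∣≡k+1 : ∣ ∁ (S - a⁻) ∣ ≡ suc k
        ∣∁[S-a⁻]∣≡k+1 = ℕ.≤-antisym ∣∁[S-a⁻]∣≤k+1 (subst (suc k ≤_) (sym ∣∁[S-a⁻]∣≡∣∁[S-b⁻]∣) k+1≤∣∁[S-b⁻]∣)

¬T⇒≡false : ∀ {b} → ¬ T b → b ≡ false
¬T⇒≡false {false} _  = refl
¬T⇒≡false {true}  ¬t = contradiction tt ¬t

module Mirror (H : PartiallyLabeledGraph) where

  open PartiallyLabeledGraph H

  labeled : SqVtx H → Bool
  labeled (inj₁ u) = isLabeled u
  labeled (inj₂ _) = false

  Labeled : SqVtx H → Set
  Labeled X = T (labeled X)

  labeled-or-not : ∀ u → T (isLabeled u) ⊎ isLabeled u ≡ false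
  labeled-or-not u with isLabeled u
  ... | true  = inj₁ tt
  ... | false = inj₂ refl

  -- Abstracting the label together with its equation keeps both branches of mirror provable.
  mirror₁ : (u : Fin h) (b : Bool) → isLabeled u ≡ b → SqVtx H
  mirror₁ u true  _       = inj₁ u
  mirror₁ u false u-unlab = inj₂ (u , u-unlab)

  mirror : SqVtx H → SqVtx H
  mirror (inj₁ u)       = mirror₁ u (isLabeled u) refl
  mirror (inj₂ (u , _)) = inj₁ u

  mirror-labeled : ∀ {u} → T (isLabeled u) → mirror (inj₁ u) ≡ inj₁ u
  mirror-labeled {u} ℓ = go (isLabeled u) refl
    where
    go : ∀ b (e : isLabeled u ≡ b) → mirror₁ u b e ≡ inj₁ u
    go true  _ = refl
    go false e = contradiction (subst T e ℓ) λ ()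

  mirror-unlabeled : ∀ {u} (e : isLabeled u ≡ false) → mirror (inj₁ u) ≡ inj₂ (u , e)
  mirror-unlabeled {u} e = go (isLabeled u) refl
    where
    go : ∀ b (e′ : isLabeled u ≡ b) → mirror₁ u b e′ ≡ inj₂ (u , e)
    go true  e′ = contradiction (trans (sym e′) e) λ ()
    go false e′ = cong (λ e″ → inj₂ (u , e″)) (Decidable⇒UIP.≡-irrelevant 𝔹._≟_ e′ e)

  mirror-fixes-labeled : ∀ X → Labeled X → mirror X ≡ X
  mirror-fixes-labeled (inj₁ u) ℓ = mirror-labeled ℓ

  mirror-involutive : ∀ X → mirror (mirror X) ≡ X
  mirror-involutive (inj₁ u) with labeled-or-not u
  ... | inj₁ ℓ = trans (cong mirror (mirror-labeled ℓ)) (mirror-labeled ℓ)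
  ... | inj₂ e = cong mirror (mirror-unlabeled e)
  mirror-involutive (inj₂ (u , e)) = mirror-unlabeled e

  mirror-adj : ∀ X Y → SqAdj H X Y → SqAdj H (mirror X) (mirror Y)
  mirror-adj (inj₁ u) (inj₁ v) uv with labeled-or-not u | labeled-or-not v
  ... | inj₁ ℓu | inj₁ ℓv = subst₂ (SqAdj H) (sym (mirror-labeled ℓu)) (sym (mirror-labeled ℓv)) uv
  ... | inj₁ ℓu | inj₂ ev = subst₂ (SqAdj H) (sym (mirror-labeled ℓu)) (sym (mirror-unlabeled ev)) (ℓu , uv)
  ... | inj₂ eu | inj₁ ℓv = subst₂ (SqAdj H) (sym (mirror-unlabeled eu)) (sym (mirror-labeled ℓv)) (ℓv , uv)
  ... | inj₂ eu | inj₂ ev = subst₂ (SqAdj H) (sym (mirror-unlabeled eu)) (sym (mirror-unlabeled ev)) uv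
  mirror-adj (inj₁ u) (inj₂ (v , _)) (ℓu , uv) = subst (λ X → SqAdj H X (inj₁ v)) (sym (mirror-labeled ℓu)) uv
  mirror-adj (inj₂ (u , _)) (inj₁ v) (ℓv , uv) = subst (SqAdj H (inj₁ u)) (sym (mirror-labeled ℓv)) uv
  mirror-adj (inj₂ _) (inj₂ _) uv = uv

  twins-common-neighbour : ∀ {u} (e : isLabeled u ≡ false) Y →
                           SqAdj H Y (inj₁ u) → SqAdj H Y (inj₂ (u , e)) → Labeled Y
  twins-common-neighbour e (inj₁ _) _        (ℓy , _) = ℓy
  twins-common-neighbour e (inj₂ _) (ℓu , _) _        = contradiction (subst T e ℓu) λ ()

  mirror-moves-unlabeled : ∀ X → ¬ Labeled X → mirror X ≢ X
  mirror-moves-unlabeled (inj₁ u) ¬ℓu eq = case trans (sym (mirror-unlabeled (¬T⇒≡false ¬ℓu))) eq of λ ()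
  mirror-moves-unlabeled (inj₂ _) _ = λ ()

  unlabeled-not-adj-mirror : ∀ X → ¬ Labeled X → ¬ SqAdj H X (mirror X)
  unlabeled-not-adj-mirror (inj₁ u) ¬ℓu adj =
    ¬ℓu (proj₁ (subst (SqAdj H (inj₁ u)) (mirror-unlabeled (¬T⇒≡false ¬ℓu)) adj))
  unlabeled-not-adj-mirror (inj₂ (u , eu)) _ (ℓu , _) = contradiction (subst T eu ℓu) λ ()

  unlabeled-common-neighbour : ∀ X → ¬ Labeled X → ∀ Y → SqAdj H Y X → SqAdj H Y (mirror X) → Labeled Y
  unlabeled-common-neighbour (inj₁ u) ¬ℓu Y YX YX′ =
    twins-common-neighbour (¬T⇒≡false ¬ℓu) Y YX (subst (SqAdj H Y) (mirror-unlabeled (¬T⇒≡false ¬ℓu)) YX′)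
  unlabeled-common-neighbour (inj₂ (u , eu)) _ Y YX YX′ = twins-common-neighbour eu Y YX′ YX

module SquareJohnson {n k : ℕ} (H : PartiallyLabeledGraph) (iso : Johnson n k ≅ square H) where

  open JohnsonGraph n k
  open Mirror H
  open PartiallyLabeledGraph H using (θ; nonempty; proper; isLabeled)

  to : Vertex → SqVtx H
  to = Bijection.to (proj₁ iso)

  from : SqVtx H → Vertex
  from X = proj₁ (Bijection.strictlySurjective (proj₁ iso) X)

  to∘from : ∀ X → to (from X) ≡ X
  to∘from X = proj₂ (Bijection.strictlySurjective (proj₁ iso) X)

  to-~ : ∀ {u v} → u ~ v → SqAdj H (to u) (to v)
  to-~ {u} {v} = Equivalence.to (proj₂ iso u v)

  from-~ : ∀ {u v} → SqAdj H (to u) (to v) → u ~ v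
  from-~ {u} {v} = Equivalence.from (proj₂ iso u v)

  ψ : Vertex → Vertex
  ψ u = from (mirror (to u))

  to∘ψ : ∀ u → to (ψ u) ≡ mirror (to u)
  to∘ψ u = to∘from (mirror (to u))

  ψ-injective : ∀ {u v} → ψ u ≡ ψ v → u ≡ v
  ψ-injective {u} {v} ψu≡ψv = Bijection.injective (proj₁ iso) (begin
    to u                   ≡⟨ mirror-involutive (to u) ⟨
    mirror (mirror (to u)) ≡⟨ cong mirror (trans (sym (to∘ψ u)) (trans (cong to ψu≡ψv) (to∘ψ v))) ⟩
    mirror (mirror (to v)) ≡⟨ mirror-involutive (to v) ⟩
    to v                   ∎)
    where open ≡-Reasoning

  ψ-~ : ∀ {u v} → u ~ v → ψ u ~ ψ v
  ψ-~ {u} {v} u~v =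
    from-~ (subst₂ (SqAdj H) (sym (to∘ψ u)) (sym (to∘ψ v)) (mirror-adj (to u) (to v) (to-~ u~v)))

  Labeledᵛ : Pred Vertex 0ℓ
  Labeledᵛ u = Labeled (to u)

  ψ-fixes-labeled : ∀ {u} → Labeledᵛ u → ψ u ≡ u
  ψ-fixes-labeled {u} ℓu = Bijection.injective (proj₁ iso) (trans (to∘ψ u) (mirror-fixes-labeled (to u) ℓu))

  unlabeled⇒≉ψ : ∀ {w} → ¬ Labeledᵛ w → ¬ (w ≈ ψ w)
  unlabeled⇒≉ψ {w} ¬ℓw w≈ψw with ≈⇒~⊎≡ {w} {ψ w} w≈ψw
  ... | inj₁ w~ψw  = unlabeled-not-adj-mirror (to w) ¬ℓw (subst (SqAdj H (to w)) (to∘ψ w) (to-~ w~ψw))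
  ... | inj₂ w≡ψw = mirror-moves-unlabeled (to w) ¬ℓw (trans (sym (to∘ψ w)) (cong to (sym w≡ψw)))

  unlabeled⇒common-neighbours-fixed : ∀ {w} → ¬ Labeledᵛ w → ∀ c → c ~ w → c ~ ψ w → ψ c ≡ c
  unlabeled⇒common-neighbours-fixed {w} ¬ℓw c c~w c~ψw = ψ-fixes-labeled
    (unlabeled-common-neighbour (to w) ¬ℓw (to c) (to-~ c~w) (subst (SqAdj H (to c)) (to∘ψ w) (to-~ c~ψw)))

  labeled-vertex : Labeledᵛ (from (inj₁ (θ (fromℕ< nonempty))))
  labeled-vertex = subst Labeled (sym (to∘from _)) (fromWitness (fromℕ< nonempty , refl))

  unlabeled-vertex : ¬ Labeledᵛ (from (inj₁ (proj₁ proper)))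
  unlabeled-vertex ℓ = proj₂ proper _ (proj₂ (toWitness (subst Labeled (to∘from _) ℓ)))

  n≡2*k : n ≡ 2 * k
  n≡2*k with crossing-edge Labeledᵛ (λ u → T? (labeled (to u))) labeled-vertex unlabeled-vertex
  ... | u , w , u~w , ℓu , ¬ℓw =
    Pivot.n≡2*k ψ ψ-injective ψ-~ {w} {u} (~-sym {u} {w} u~w) (ψ-fixes-labeled ℓu)
                (unlabeled⇒≉ψ ¬ℓw) (unlabeled⇒common-neighbours-fixed ¬ℓw)

theorem4p15 : (n k : ℕ) → 1 ≤ n → k ≤ n → ¬ (n ≡ 2 * k) → ¬ IsSquare (Johnson n k)
theorem4p15 n k _ _ n≢2k (H , iso) = n≢2k (SquareJohnson.n≡2*k H iso)
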